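{- The modal logic $\mathsf{K4}$ is complete for finite transitive provability models with necessitation: if $A\in\mathcal L_\Box$ holds at every world of every provability model with finitely many worlds, transitive accessibility relation, and necessitation, then $\mathsf{K4}\vdash A$.
   Context: $\mathsf{K4}$ is $\mathsf K$ (the smallest normal modal logic) plus $\Box A\to\Box\Box A$. Language $\mathcal L_\Box$: formulas built from atomic propositions and $\bot$ using $\to$ and a unary $\Box$. A formula is purely modal if it is a Boolean combination of formulas $\Box B$. A theory is a pair of a set of axioms and a set of inference rules (finitely many premises, one conclusion); $\mathsf T\vdash A$ means derivability from axioms by rules. A theory is classical if modus ponens is one of its rules and all classical tautologies are derivable. A provability pre-model is $\mathcal P=(W,\sqsubset,\{L_w\}_{w\in W^\sqsubset},V)$ with $W$ nonempty, $\sqsubset$ a binary relation on $W$, $V\subseteq W\times\mathrm{atoms}$, $W^\sqsubset=\{u:\exists v\,(v\sqsubset u)\}$, and a theory $L_w$ for each $w\in W^\sqsubset$. Satisfaction: atoms via $V$, $\bot$ never holds, $\to$ classical, $\mathcal P,w\Vdash\Box A$ iff $L_u\vdash A$ for all $u$ with $w\sqsubset u$. With $\sqsubset^+$ the transitive closure, $\mathcal P,w\Vdash^+A$ iff there is $u\sqsubset w$ with $\mathcal P,v\Vdash A$ for all $v$ such that $u\sqsubset^+v$. A provability model is a pre-model in which every $L_w$ is classical and which satisfies modal completeness: for every $w\in W^\sqsubset$ and purely modal $A$, $\mathcal P,w\Vdash^+A$ implies $L_w\vdash A$. A provability model has necessitation if every $L_w$ has the rule "from $A$ infer $\Box A$"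 among its rules. -}

module Defs where

open import Data.Nat using (ℕ)
open import Data.Bool using (Bool; true; false; if_then_else_)
open import Data.List using (List; []; _∷_)
open import Data.List.Relation.Unary.All using (All)
open import Data.Product using (Σ; ∃; _×_; _,_)
open import Data.Sum using (_⊎_)
open import Data.Empty renaming (⊥ to Empty)
open import Data.Fin using (Fin)
open import Function.Bundles using (_↔_)
open import Relation.Binary.PropositionalEquality using (_≡_)
open import Relation.Binary.Definitions using (Transitive)
open import Relation.Binary.Construct.Closure.Transitive using (TransClosure)

infixr 5 _⇒_
data Formula : Set where
  atom : ℕ → Formula
  ⊥′   : Formula
  _⇒_  : Formula → Formula → Formula
  □_   : Formula → Formula

data PurelyModal : Formula → Set where
  pm-□ : ∀ B → PurelyModal (□ B)
  pm-⊥ : PurelyModal ⊥′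
  pm-⇒ : ∀ {A B} → PurelyModal A → PurelyModal B → PurelyModal (A ⇒ B)

-- Classical tautologies: true under every Boolean assignment to the
-- propositionally-atomic subformulas (atoms and boxed formulas)

evalB : (ℕ → Bool) → (Formula → Bool) → Formula → Bool
evalB v b (atom p) = v p
evalB v b ⊥′       = false
evalB v b (A ⇒ B)  = if evalB v b A then evalB v b B else true
evalB v b (□ A)    = b A

Tautology : Formula → Set
Tautology A = ∀ (v : ℕ → Bool) (b : Formula → Bool) → evalB v b A ≡ true

record Theory : Set₁ where
  field
    Ax   : Formula → Set
    Rule : List Formula → Formula → Set
open Theory public

data _⊢_ (T : Theory) : Formula → Set where
  ax   : ∀ {A} → Ax T A → T ⊢ A
  rule : ∀ {Γ A} → Rule T Γ A → All (T ⊢_) Γ → T ⊢ A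

HasMP : Theory → Set
HasMP T = ∀ A B → Rule T (A ∷ (A ⇒ B) ∷ []) B

Classical : Theory → Set
Classical T = HasMP T × (∀ A → Tautology A → T ⊢ A)

HasNec : Theory → Set
HasNec T = ∀ A → Rule T (A ∷ []) (□ A)

data K4Ax : Formula → Set where
  taut : ∀ {A} → Tautology A → K4Ax A
  axK  : ∀ A B → K4Ax (□ (A ⇒ B) ⇒ (□ A ⇒ □ B))
  ax4  : ∀ A → K4Ax (□ A ⇒ □ (□ A))

data K4Rule : List Formula → Formula → Set where
  mp  : ∀ A B → K4Rule (A ∷ (A ⇒ B) ∷ []) B
  nec : ∀ A → K4Rule (A ∷ []) (□ A)

K4 : Theory
K4 = record { Ax = K4Ax ; Rule = K4Rule }

-- Provability pre-models.  The family {L_w} is given as a total function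
-- W → Theory; only its values on W^⊏ matter (all conditions below and the
-- semantics only ever use L_u for u in W^⊏).

record PreModel : Set₁ where
  field
    W    : Set
    w₀   : W                       -- W is nonempty
    _⊏_  : W → W → Set
    L    : W → Theory
    V    : W → ℕ → Set

  InDom : W → Set
  InDom u = ∃ λ v → v ⊏ u

  _⊏⁺_ : W → W → Set
  _⊏⁺_ = TransClosure _⊏_

  infix 4 _⊩_ _⊩⁺_
  _⊩_ : W → Formula → Set
  w ⊩ atom p = V w p
  w ⊩ ⊥′     = Empty
  w ⊩ (A ⇒ B) = w ⊩ A → w ⊩ B
  w ⊩ (□ A)   = ∀ u → w ⊏ u → L u ⊢ A

  _⊩⁺_ : W → Formula → Set
  w ⊩⁺ A = ∃ λ u → u ⊏ w × (∀ v → u ⊏⁺ v → v ⊩ A)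

open PreModel public

IsProvabilityModel : PreModel → Set
IsProvabilityModel P =
    (∀ w → InDom P w → Classical (L P w))
  × (∀ w → InDom P w → ∀ A → PurelyModal A → _⊩⁺_ P w A → L P w ⊢ A)

HasNecessitation : PreModel → Set
HasNecessitation P = ∀ w → InDom P w → HasNec (L P w)

IsFinite : PreModel → Set
IsFinite P = Σ ℕ λ n → Fin n ↔ W P

IsTransitive : PreModel → Set
IsTransitive P = Transitive (_⊏_ P)

-- Completeness by elimination of Hintikka worlds.  A world is a truth assignment to the atoms
-- and boxed subformulas of A; let ≺ be the K4 accessibility "□B at w implies B and □B at u".
-- Starting from all worlds, repeatedly discard a world w at which some □B is false although
-- no surviving ≺-successor falsifies B.  Each discarded world is refutable in K4: the
-- successors falsifying B are refutable, so K4 ⊢ Γ_w → B, where Γ_w consists of all C and □C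
-- with □C true at w, and necessitation, K and 4 turn this into ⊢ ¬χ_w.  The surviving worlds
-- form a finite transitive Kripke model obeying the truth lemma, and such a model is a
-- provability model with necessitation once L_i is taken to be the set of formulas valid on
-- the cone of i.  So A holds at every surviving world, every other world is refutable, and
-- K4 ⊢ A follows propositionally.

module Submission where

open import Defs
open import Data.Nat using (ℕ; suc; _<_; s≤s)
import Data.Nat.Properties as ℕ
open import Data.Bool using (Bool; true; false; T; if_then_else_)
import Data.Bool.Properties as Bool
open import Data.Fin using (Fin)
import Data.Fin.Properties as Fin
open import Data.Vec using (Vec; []; _∷_)
import Data.Vec.Properties as Vec
open import Data.List using (List; []; _∷_; _++_; map; filter; length; lookup; cartesianProductWith)
open import Data.List.Properties using (filter-notAll)
open import Data.List.Relation.Binary.Subset.Propositional using (_⊆_)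
open import Data.List.Relation.Unary.All as All using (All; []; _∷_)
open import Data.List.Relation.Unary.All.Properties using (¬All⇒Any¬; ++⁺; ++⁻; map⁺; map⁻)
open import Data.List.Relation.Unary.Any as Any using (Any; here; there; index)
open import Data.List.Relation.Unary.Any.Properties using (lookup-index)
open import Data.List.Membership.Propositional using (_∈_; _∉_; find; lose)
open import Data.List.Membership.Propositional.Properties
  using (∈-++⁺ˡ; ∈-++⁺ʳ; ∈-++⁻; ∈-filter⁺; ∈-filter⁻; ∈-lookup; ∈-cartesianProductWith⁺)
open import Data.Product using (_×_; _,_; proj₁; proj₂)
open import Data.Sum using (_⊎_; inj₁; inj₂)
open import Data.Empty using (⊥-elim)
open import Function using (_∘_; id)
open import Function.Bundles using (_⇔_; mk⇔; Equivalence)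
open import Function.Construct.Identity using (↔-id)
open import Relation.Binary.Definitions using (Decidable; Transitive; DecidableEquality)
open import Relation.Binary.PropositionalEquality using (_≡_; refl; sym; trans; cong₂; subst)
open import Relation.Binary.Construct.Closure.Transitive using ([_]; _∷_)
open import Relation.Nullary using (Dec; yes; no; ¬_; ¬?; _×-dec_; _⊎-dec_; _→-dec_)
open import Relation.Nullary.Decidable using (T?; ⌊_⌋; toWitness; fromWitness)

open Equivalence using (to; from)

T-⇒ : ∀ {x y} → T (if x then y else true) ⇔ (T x → T y)
T-⇒ {true}  = mk⇔ (λ y _ → y) (λ f → f _)
T-⇒ {false} = mk⇔ (λ _ ()) _

T-ext : ∀ {x y} → (T x → T y) → (T y → T x) → x ≡ y
T-ext {true}  {true}  _ _ = refl
T-ext {true}  {false} f _ = ⊥-elim (f _)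
T-ext {false} {true}  _ g = ⊥-elim (g _)
T-ext {false} {false} _ _ = refl

infix 4 _≟_
_≟_ : DecidableEquality Formula
atom p ≟ atom q with p ℕ.≟ q
... | yes refl = yes refl
... | no p≢q   = no λ { refl → p≢q refl }
⊥′ ≟ ⊥′ = yes refl
(X ⇒ Y) ≟ (X′ ⇒ Y′) with X ≟ X′ | Y ≟ Y′
... | yes refl | yes refl = yes refl
... | no X≢X′  | _        = no λ { refl → X≢X′ refl }
... | yes _    | no Y≢Y′  = no λ { refl → Y≢Y′ refl }
(□ X) ≟ (□ Y) with X ≟ Y
... | yes refl = yes refl
... | no X≢Y   = no λ { refl → X≢Y refl }
atom _  ≟ ⊥′      = no λ ()
atom _  ≟ (_ ⇒ _) = no λ ()
atom _  ≟ (□ _)   = no λ ()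
⊥′      ≟ atom _  = no λ ()
⊥′      ≟ (_ ⇒ _) = no λ ()
⊥′      ≟ (□ _)   = no λ ()
(_ ⇒ _) ≟ atom _  = no λ ()
(_ ⇒ _) ≟ ⊥′      = no λ ()
(_ ⇒ _) ≟ (□ _)   = no λ ()
(□ _)   ≟ atom _  = no λ ()
(□ _)   ≟ ⊥′      = no λ ()
(□ _)   ≟ (_ ⇒ _) = no λ ()

infixr 5 _⇒*_
_⇒*_ : List Formula → Formula → Formula
[]       ⇒* Y = Y
(X ∷ Xs) ⇒* Y = X ⇒ (Xs ⇒* Y)

infix 4 ⊨[_,_]_
⊨[_,_]_ : (ℕ → Bool) → (Formula → Bool) → Formula → Set
⊨[ v , b ] X = T (evalB v b X)

module _ {v : ℕ → Bool} {b : Formula → Bool} where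

  ⊨-⇒* : ∀ Xs {Y} → ⊨[ v , b ] (Xs ⇒* Y) ⇔ (All (⊨[ v , b ]_) Xs → ⊨[ v , b ] Y)
  ⊨-⇒* []       = mk⇔ (λ y _ → y) (λ f → f [])
  ⊨-⇒* (X ∷ Xs) = mk⇔
    (λ { h (x ∷ xs) → to (⊨-⇒* Xs) (to T-⇒ h x) xs })
    (λ f → from T-⇒ λ x → from (⊨-⇒* Xs) (f ∘ (x ∷_)))

  ⊭-⇒* : ∀ Xs {Y} → ¬ ⊨[ v , b ] (Xs ⇒* Y) → All (⊨[ v , b ]_) Xs × ¬ ⊨[ v , b ] Y
  ⊭-⇒* Xs ⊭Xs⇒Y with All.all? (λ X → T? (evalB v b X)) Xs
  ... | yes ⊨Xs = ⊨Xs , λ ⊨Y → ⊭Xs⇒Y (from (⊨-⇒* Xs) λ _ → ⊨Y)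
  ... | no ⊭Xs  = ⊥-elim (⊭Xs⇒Y (from (⊨-⇒* Xs) (⊥-elim ∘ ⊭Xs)))

  ⊨-refutation : ∀ Xs → ⊨[ v , b ] (Xs ⇒* ⊥′) ⇔ (¬ All (⊨[ v , b ]_) Xs)
  ⊨-refutation Xs = mk⇔ (to (⊨-⇒* Xs)) (λ ¬xs → from (⊨-⇒* Xs) (⊥-elim ∘ ¬xs))

⊢-⇒*-elim : ∀ {Th Xs Y} → HasMP Th → Th ⊢ (Xs ⇒* Y) → All (Th ⊢_) Xs → Th ⊢ Y
⊢-⇒*-elim hasMP ⊢Y   []         = ⊢Y
⊢-⇒*-elim hasMP ⊢X⇒Y (⊢X ∷ ⊢Xs) = ⊢-⇒*-elim hasMP (rule (hasMP _ _) (⊢X ∷ ⊢X⇒Y ∷ [])) ⊢Xs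

⊢-consequence : ∀ {Th Xs Y} → Classical Th → All (Th ⊢_) Xs
  → (∀ v b → All (⊨[ v , b ]_) Xs → ⊨[ v , b ] Y) → Th ⊢ Y
⊢-consequence {Xs = Xs} (hasMP , ⊢taut) ⊢Xs entails =
  ⊢-⇒*-elim hasMP (⊢taut _ λ v b → to Bool.T-≡ (from (⊨-⇒* Xs) (entails v b))) ⊢Xs

K4-classical : Classical K4
K4-classical = mp , λ A t → ax (taut t)

K4-□-⇒* : ∀ Γ C → K4 ⊢ (□ (Γ ⇒* C) ⇒ (map □_ Γ ⇒* □ C))
K4-□-⇒* []      C = ⊢-consequence K4-classical [] λ _ b _ → from (T-⇒ {b C}) id
K4-□-⇒* (X ∷ Γ) C = ⊢-consequence K4-classical (ax (axK X (Γ ⇒* C)) ∷ K4-□-⇒* Γ C ∷ [])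
  λ { v b (k ∷ ih ∷ []) → from T-⇒ λ □[X⇒Γ⇒C] → from T-⇒ λ □X →
        to (T-⇒ {b (Γ ⇒* C)}) ih (to (T-⇒ {b X}) (to (T-⇒ {b (X ⇒ (Γ ⇒* C))}) k □[X⇒Γ⇒C]) □X) }

K4-□-lift : ∀ {Γ C} → K4 ⊢ (Γ ⇒* C) → K4 ⊢ (map □_ Γ ⇒* □ C)
K4-□-lift {Γ} {C} ⊢Γ⇒C = rule (mp _ _) (rule (nec _) (⊢Γ⇒C ∷ []) ∷ K4-□-⇒* Γ C ∷ [])

ProvabilityValid : Formula → Set₁
ProvabilityValid A = ∀ (P : PreModel) → IsProvabilityModel P → IsFinite P → IsTransitive P
  → HasNecessitation P → ∀ (w : W P) → _⊩_ P w A

module FiniteKripke {N : ℕ} {_≺_ : Fin N → Fin N → Set}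
  (_≺?_ : Decidable _≺_) (≺-trans : Transitive _≺_) (val : Fin N → ℕ → Bool) where

  ⟦_⟧ : Formula → Fin N → Bool
  ⟦ atom p ⟧ i = val i p
  ⟦ ⊥′ ⟧     i = false
  ⟦ X ⇒ Y ⟧  i = if ⟦ X ⟧ i then ⟦ Y ⟧ i else true
  ⟦ □ X ⟧    i = ⌊ Fin.all? (λ j → i ≺? j →-dec T? (⟦ X ⟧ j)) ⌋

  ⟦□⟧ : ∀ {i} X → T (⟦ □ X ⟧ i) ⇔ (∀ j → i ≺ j → T (⟦ X ⟧ j))
  ⟦□⟧ X = mk⇔ toWitness fromWitness

  ⟦⟧-evalB : ∀ i D → ⟦ D ⟧ i ≡ evalB (val i) (λ B → ⟦ □ B ⟧ i) D
  ⟦⟧-evalB i (atom p) = refl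
  ⟦⟧-evalB i ⊥′       = refl
  ⟦⟧-evalB i (X ⇒ Y)  = cong₂ (λ x y → if x then y else true) (⟦⟧-evalB i X) (⟦⟧-evalB i Y)
  ⟦⟧-evalB i (□ X)    = refl

  ⟦⟧-tautology : ∀ A → Tautology A → ∀ i → T (⟦ A ⟧ i)
  ⟦⟧-tautology A ⊨A i = from Bool.T-≡ (trans (⟦⟧-evalB i A) (⊨A _ _))

  ValidFrom : Fin N → Formula → Set
  ValidFrom i A = T (⟦ A ⟧ i) × (∀ j → i ≺ j → T (⟦ A ⟧ j))

  theory : Fin N → Theory
  theory i = record { Ax = ValidFrom i ; Rule = K4Rule }

  theory-sound : ∀ {i A} → theory i ⊢ A → ValidFrom i A
  theory-sound (ax valid) = valid
  theory-sound (rule (mp X A) (⊢X ∷ ⊢X⇒A ∷ [])) with theory-sound ⊢X | theory-sound ⊢X⇒A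
  ... | x , xs | x⇒a , xs⇒as = to T-⇒ x⇒a x , λ j i≺j → to T-⇒ (xs⇒as j i≺j) (xs j i≺j)
  theory-sound (rule (nec X) (⊢X ∷ [])) with theory-sound ⊢X
  ... | _ , xs = from (⟦□⟧ X) xs
               , λ j i≺j → from (⟦□⟧ X) λ k j≺k → xs k (≺-trans i≺j j≺k)

  model : Fin N → PreModel
  model w₀ = record { W = Fin N ; w₀ = w₀ ; _⊏_ = _≺_ ; L = theory ; V = λ i p → T (val i p) }

  module _ {w₀ : Fin N} where

    ⊩⇔⟦⟧ : ∀ D i → _⊩_ (model w₀) i D ⇔ T (⟦ D ⟧ i)
    ⊩⇔⟦⟧ (atom p) i = mk⇔ id id
    ⊩⇔⟦⟧ ⊥′       i = mk⇔ (λ ()) (λ ())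
    ⊩⇔⟦⟧ (X ⇒ Y)  i = mk⇔
      (λ f → from T-⇒ (to (⊩⇔⟦⟧ Y i) ∘ f ∘ from (⊩⇔⟦⟧ X i)))
      (λ x⇒y → from (⊩⇔⟦⟧ Y i) ∘ to T-⇒ x⇒y ∘ to (⊩⇔⟦⟧ X i))
    ⊩⇔⟦⟧ (□ X)    i = mk⇔
      (λ ⊢X → from (⟦□⟧ X) λ j i≺j → proj₁ (theory-sound (⊢X j i≺j)))
      (λ □x j i≺j → ax (to (⟦□⟧ X) □x j i≺j , λ k j≺k → to (⟦□⟧ X) □x k (≺-trans i≺j j≺k)))

    -- Modal completeness holds for every formula.
    model-isProvabilityModel : IsProvabilityModel (model w₀)
    model-isProvabilityModel =
        (λ _ _ → mp , λ A ⊨A → ax (⟦⟧-tautology A ⊨A _ , λ j _ → ⟦⟧-tautology A ⊨A j))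
      , λ { i _ A _ (u , u≺i , cone) → ax
              ( to (⊩⇔⟦⟧ A i) (cone i [ u≺i ])
              , λ j i≺j → to (⊩⇔⟦⟧ A j) (cone j (u≺i ∷ [ i≺j ])) ) }

  provabilityValid⇒⟦⟧ : ∀ A → ProvabilityValid A → ∀ i → T (⟦ A ⟧ i)
  provabilityValid⇒⟦⟧ A valid i =
    to (⊩⇔⟦⟧ A i) (valid (model i) model-isProvabilityModel (N , ↔-id _) ≺-trans (λ _ _ → nec) i)

letters : Formula → List Formula
letters (atom p) = atom p ∷ []
letters ⊥′       = []
letters (X ⇒ Y)  = letters X ++ letters Y
letters (□ X)    = □ X ∷ []

subletters : Formula → List Formula
subletters (atom p) = atom p ∷ []
subletters ⊥′       = []
subletters (X ⇒ Y)  = subletters X ++ subletters Y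
subletters (□ X)    = □ X ∷ subletters X

boxed : Formula → List Formula
boxed (atom p) = []
boxed ⊥′       = []
boxed (X ⇒ Y)  = boxed X ++ boxed Y
boxed (□ X)    = X ∷ boxed X

letters⊆subletters : ∀ D → letters D ⊆ subletters D
letters⊆subletters (atom p) G∈ = G∈
letters⊆subletters (X ⇒ Y)  G∈ with ∈-++⁻ (letters X) G∈
... | inj₁ G∈X = ∈-++⁺ˡ (letters⊆subletters X G∈X)
... | inj₂ G∈Y = ∈-++⁺ʳ (subletters X) (letters⊆subletters Y G∈Y)
letters⊆subletters (□ X)    (here refl) = here refl

∈-boxed : ∀ D {B} → B ∈ boxed D → □ B ∈ subletters D × subletters B ⊆ subletters D
∈-boxed (X ⇒ Y) B∈ with ∈-++⁻ (boxed X) B∈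
... | inj₁ B∈X = let □B∈ , B⊆ = ∈-boxed X B∈X in ∈-++⁺ˡ □B∈ , ∈-++⁺ˡ ∘ B⊆
... | inj₂ B∈Y = let □B∈ , B⊆ = ∈-boxed Y B∈Y
                in ∈-++⁺ʳ (subletters X) □B∈ , ∈-++⁺ʳ (subletters X) ∘ B⊆
∈-boxed (□ X) (here refl) = here refl , there
∈-boxed (□ X) (there B∈X) = let □B∈ , B⊆ = ∈-boxed X B∈X in there □B∈ , there ∘ B⊆

letters-⇒*-⊆ : ∀ {L} Xs {Y} → All (λ X → letters X ⊆ L) Xs → letters Y ⊆ L → letters (Xs ⇒* Y) ⊆ L
letters-⇒*-⊆ []       []           Y⊆ = Y⊆
letters-⇒*-⊆ (X ∷ Xs) (X⊆ ∷ Xs⊆) Y⊆ G∈ with ∈-++⁻ (letters X) G∈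
... | inj₁ G∈X  = X⊆ G∈X
... | inj₂ G∈Xs = letters-⇒*-⊆ Xs Xs⊆ Y⊆ G∈Xs

eval : (Formula → Bool) → Formula → Bool
eval f = evalB (f ∘ atom) (f ∘ □_)

eval-cong : ∀ {f g} D → (∀ {G} → G ∈ letters D → f G ≡ g G) → eval f D ≡ eval g D
eval-cong (atom p) f≗g = f≗g (here refl)
eval-cong ⊥′       f≗g = refl
eval-cong (X ⇒ Y)  f≗g = cong₂ (λ x y → if x then y else true)
  (eval-cong X (f≗g ∘ ∈-++⁺ˡ)) (eval-cong Y (f≗g ∘ ∈-++⁺ʳ (letters X)))
eval-cong (□ X)    f≗g = f≗g (here refl)

Assignment : List Formula → Set
Assignment Fs = Vec Bool (length Fs)

assignments : ∀ n → List (Vec Bool n)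
assignments 0       = [] ∷ []
assignments (suc n) = cartesianProductWith _∷_ (true ∷ false ∷ []) (assignments n)

∈-assignments : ∀ {n} (xs : Vec Bool n) → xs ∈ assignments n
∈-assignments []          = here refl
∈-assignments (true ∷ xs)  =
  ∈-cartesianProductWith⁺ _∷_ {true ∷ false ∷ []} (here refl) (∈-assignments xs)
∈-assignments (false ∷ xs) =
  ∈-cartesianProductWith⁺ _∷_ {true ∷ false ∷ []} (there (here refl)) (∈-assignments xs)

look : (Fs : List Formula) → Assignment Fs → Formula → Bool
look []       []       G = false
look (F ∷ Fs) (x ∷ xs) G with F ≟ G
... | yes _ = x
... | no _  = look Fs xs G

literal : Formula → Bool → Formula
literal F true  = F
literal F false = F ⇒ ⊥′

literals : (Fs : List Formula) → Assignment Fs → List Formula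
literals []       []       = []
literals (F ∷ Fs) (x ∷ xs) = literal F x ∷ literals Fs xs

restrict : (ℕ → Bool) → (Formula → Bool) → (Fs : List Formula) → Assignment Fs
restrict v b []       = []
restrict v b (F ∷ Fs) = evalB v b F ∷ restrict v b Fs

module _ {v : ℕ → Bool} {b : Formula → Bool} where

  ⊨-literal : ∀ F x → ⊨[ v , b ] literal F x ⇔ (evalB v b F ≡ x)
  ⊨-literal F true  = Bool.T-≡
  ⊨-literal F false with evalB v b F
  ... | true  = mk⇔ (λ ()) (λ ())
  ... | false = mk⇔ (λ _ → refl) (λ _ → _)

  ⊨-literals-restrict : ∀ Fs → All (⊨[ v , b ]_) (literals Fs (restrict v b Fs))
  ⊨-literals-restrict []       = []
  ⊨-literals-restrict (F ∷ Fs) = from (⊨-literal F _) refl ∷ ⊨-literals-restrict Fs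

  ⊨-literals⇒look : ∀ Fs {xs G} → All (⊨[ v , b ]_) (literals Fs xs) → G ∈ Fs
                  → look Fs xs G ≡ evalB v b G
  ⊨-literals⇒look (F ∷ Fs) {x ∷ xs} {G} (lit ∷ lits) G∈ with F ≟ G | G∈
  ... | yes refl | _           = sym (to (⊨-literal F x) lit)
  ... | no F≢G   | here refl   = ⊥-elim (F≢G refl)
  ... | no _     | there G∈Fs = ⊨-literals⇒look Fs lits G∈Fs

  look-restrict : ∀ Fs {G} → G ∈ Fs → look Fs (restrict v b Fs) G ≡ evalB v b G
  look-restrict Fs = ⊨-literals⇒look Fs (⊨-literals-restrict Fs)

module Completeness (A : Formula) where

  Λ : List Formula
  Λ = subletters A

  Bs : List Formula
  Bs = boxed A

  World : Set
  World = Assignment Λ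

  worlds : List World
  worlds = assignments (length Λ)

  infix 4 _⊨_ _⊨?_
  _⊨_ : World → Formula → Set
  w ⊨ D = T (eval (look Λ w) D)

  _⊨?_ : ∀ w D → Dec (w ⊨ D)
  w ⊨? D = T? _

  _≟W_ : DecidableEquality World
  _≟W_ = Vec.≡-dec Bool._≟_

  _≺_ : World → World → Set
  w ≺ u = All (λ B → w ⊨ □ B → u ⊨ B × u ⊨ □ B) Bs

  _≺?_ : Decidable _≺_
  w ≺? u = All.all? (λ B → w ⊨? □ B →-dec (u ⊨? B ×-dec u ⊨? □ B)) Bs

  ≺-trans : Transitive _≺_
  ≺-trans w≺u u≺v = All.zipWith (λ (f , g) w⊨□B → g (proj₂ (f w⊨□B))) (w≺u , u≺v)

  -- ⊢ ¬ χ_w, where the characteristic formula χ_w is the conjunction of the literals of w.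
  Refutable : World → Set
  Refutable w = K4 ⊢ (literals Λ w ⇒* ⊥′)

  eval-restrict : ∀ v b D → letters D ⊆ Λ → eval (look Λ (restrict v b Λ)) D ≡ evalB v b D
  eval-restrict v b D D⊆Λ = eval-cong D (look-restrict {v} {b} Λ ∘ D⊆Λ)

  DeadRefutable : List World → Set
  DeadRefutable alive = ∀ w → w ∉ alive → Refutable w

  ⊢-if-countermodels-refutable : ∀ {D} → letters D ⊆ Λ → (∀ w → ¬ w ⊨ D → Refutable w) → K4 ⊢ D
  ⊢-if-countermodels-refutable {D} D⊆Λ refutable = ⊢-consequence K4-classical
    (map⁺ (All.tabulate λ w∈ → refutable _ (proj₂ (∈-filter⁻ ⊭? {xs = worlds} w∈)))) entails
    where
    ⊭? : ∀ w → Dec (¬ w ⊨ D)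
    ⊭? w = ¬? (w ⊨? D)

    countermodels : List World
    countermodels = filter ⊭? worlds

    entails : ∀ v b → All (⊨[ v , b ]_) (map (λ w → literals Λ w ⇒* ⊥′) countermodels)
            → ⊨[ v , b ] D
    entails v b refuted with T? (evalB v b D)
    ... | yes ⊨D = ⊨D
    ... | no ⊭D  =
      ⊥-elim (to (⊨-refutation (literals Λ w)) (All.lookup (map⁻ refuted) w∈) (⊨-literals-restrict Λ))
      where
      w : World
      w = restrict v b Λ
      w∈ : w ∈ countermodels
      w∈ = ∈-filter⁺ ⊭? {xs = worlds} (∈-assignments w) (⊭D ∘ subst T (eval-restrict v b D D⊆Λ))

  boxed⇒letters⊆Λ : ∀ {B} → B ∈ Bs → letters B ⊆ Λ × letters (□ B) ⊆ Λ
  boxed⇒letters⊆Λ {B} B∈ = proj₂ (∈-boxed A B∈) ∘ letters⊆subletters B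
                         , λ { (here refl) → proj₁ (∈-boxed A B∈) }

  boxedAt : World → List Formula
  boxedAt w = filter (λ B → w ⊨? □ B) Bs

  Γ : World → List Formula
  Γ w = boxedAt w ++ map □_ (boxedAt w)

  ⊨Γ⇒≺ : ∀ {w u} → All (u ⊨_) (Γ w) → w ≺ u
  ⊨Γ⇒≺ {w} ⊨Γ = All.tabulate λ B∈ w⊨□B →
    let B∈boxedAt = ∈-filter⁺ (λ B → w ⊨? □ B) B∈ w⊨□B
        ⊨boxedAt , ⊨□boxedAt = ++⁻ (boxedAt w) ⊨Γ
    in All.lookup ⊨boxedAt B∈boxedAt , All.lookup (map⁻ ⊨□boxedAt) B∈boxedAt

  ⊢Γ⇒ : ∀ {w B} → B ∈ Bs → (∀ u → w ≺ u → ¬ u ⊨ B → Refutable u) → K4 ⊢ (Γ w ⇒* B)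
  ⊢Γ⇒ {w} {B} B∈ refutable = ⊢-if-countermodels-refutable Γ⇒B⊆Λ λ u u⊭Γ⇒B →
    let ⊨Γ , u⊭B = ⊭-⇒* {look Λ u ∘ atom} {look Λ u ∘ □_} (Γ w) u⊭Γ⇒B
    in refutable u (⊨Γ⇒≺ ⊨Γ) u⊭B
    where
    boxedAt⊆Bs : ∀ {C} → C ∈ boxedAt w → C ∈ Bs
    boxedAt⊆Bs = proj₁ ∘ ∈-filter⁻ (λ C → w ⊨? □ C)

    Γ⇒B⊆Λ : letters (Γ w ⇒* B) ⊆ Λ
    Γ⇒B⊆Λ = letters-⇒*-⊆ (Γ w)
      (++⁺ (All.tabulate (proj₁ ∘ boxed⇒letters⊆Λ ∘ boxedAt⊆Bs))
           (map⁺ (All.tabulate (proj₂ ∘ boxed⇒letters⊆Λ ∘ boxedAt⊆Bs))))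
      (proj₁ (boxed⇒letters⊆Λ B∈))

  -- χ_w fixes the truth value of each □C with C ∈ Bs; with axiom 4 it makes every formula of
  -- □Γ_w true, hence □B by the lifted derivation, contradicting the literal ¬□B of χ_w.
  refutable-if-⊢Γ⇒ : ∀ {w B} → B ∈ Bs → ¬ w ⊨ □ B → K4 ⊢ (Γ w ⇒* B) → Refutable w
  refutable-if-⊢Γ⇒ {w} {B} B∈ w⊭□B ⊢Γ⇒B =
    ⊢-consequence K4-classical
      (K4-□-lift ⊢Γ⇒B ∷ map⁺ (All.universal (ax ∘ ax4) (boxedAt w))) entails
    where
    entails : ∀ v b
      → All (⊨[ v , b ]_) ((map □_ (Γ w) ⇒* □ B) ∷ map (λ C → □ C ⇒ □ (□ C)) (boxedAt w))
      → ⊨[ v , b ] (literals Λ w ⇒* ⊥′)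
    entails v b (⊨□Γ⇒□B ∷ ⊨4) = from (⊨-refutation (literals Λ w)) λ ⊨w →
      let pinned : ∀ {C} → C ∈ Bs → look Λ w (□ C) ≡ b C
          pinned C∈ = ⊨-literals⇒look Λ ⊨w (proj₁ (∈-boxed A C∈))
          ⊨□boxedAt : All (λ C → T (b C)) (boxedAt w)
          ⊨□boxedAt = All.tabulate λ C∈ →
            let C∈Bs , w⊨□C = ∈-filter⁻ (λ C → w ⊨? □ C) C∈
            in subst T (pinned C∈Bs) w⊨□C
          ⊨□□boxedAt : All (λ C → T (b (□ C))) (boxedAt w)
          ⊨□□boxedAt = All.zipWith (λ (four , □C) → to T-⇒ four □C) (map⁻ ⊨4 , ⊨□boxedAt)
          ⊨□Γ : All (⊨[ v , b ]_) (map □_ (Γ w))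
          ⊨□Γ = map⁺ (++⁺ ⊨□boxedAt (map⁺ ⊨□□boxedAt))
      in w⊭□B (subst T (sym (pinned B∈)) (to (⊨-⇒* (map □_ (Γ w))) ⊨□Γ⇒□B ⊨□Γ))

  SupportedAt : List World → World → Formula → Set
  SupportedAt alive w B = w ⊨ □ B ⊎ Any (λ u → w ≺ u × ¬ u ⊨ B) alive

  supportedAt? : ∀ alive w B → Dec (SupportedAt alive w B)
  supportedAt? alive w B = w ⊨? □ B ⊎-dec Any.any? (λ u → w ≺? u ×-dec ¬? (u ⊨? B)) alive

  Supported : List World → World → Set
  Supported alive w = All (SupportedAt alive w) Bs

  supported? : ∀ alive w → Dec (Supported alive w)
  supported? alive w = All.all? (supportedAt? alive w) Bs

  refutable-if-unsupported : ∀ {alive w} → DeadRefutable alive → ¬ Supported alive w → Refutable w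
  refutable-if-unsupported {alive} {w} dead-refutable unsupported
    with find (¬All⇒Any¬ (supportedAt? alive w) Bs unsupported)
  ... | B , B∈ , ¬supportedAt = refutable-if-⊢Γ⇒ B∈ (¬supportedAt ∘ inj₁) (⊢Γ⇒ B∈ λ u w≺u u⊭B →
    dead-refutable u λ u∈ → ¬supportedAt (inj₂ (lose u∈ (w≺u , u⊭B))))

  record Pruned : Set where
    field
      alive           : List World
      dead-refutable  : DeadRefutable alive
      alive-supported : All (Supported alive) alive

  prune : ∀ alive fuel → length alive < fuel → DeadRefutable alive → Pruned
  prune alive (suc fuel) (s≤s |alive|≤fuel) dead-refutable
    with All.all? (supported? alive) alive
  ... | yes supported =
    record { alive = alive ; dead-refutable = dead-refutable ; alive-supported = supported }
  ... | no ¬supported with find (¬All⇒Any¬ (supported? alive) alive ¬supported)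
  ... | w , w∈ , unsupported =
    prune (filter ≢w? alive) fuel (ℕ.<-≤-trans shrinks |alive|≤fuel) dead-refutable′
    where
    ≢w? : ∀ u → Dec (¬ u ≡ w)
    ≢w? u = ¬? (u ≟W w)

    shrinks : length (filter ≢w? alive) < length alive
    shrinks = filter-notAll ≢w? alive (Any.map (λ { refl u≢u → u≢u refl }) w∈)

    dead-refutable′ : DeadRefutable (filter ≢w? alive)
    dead-refutable′ u u∉ with u ≟W w
    ... | yes refl = refutable-if-unsupported dead-refutable unsupported
    ... | no u≢w   = dead-refutable u λ u∈ → u∉ (∈-filter⁺ ≢w? u∈ u≢w)

  pruned : Pruned
  pruned = prune worlds (suc (length worlds)) (ℕ.n<1+n _) λ w w∉ → ⊥-elim (w∉ (∈-assignments w))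

  open Pruned pruned public

  world : Fin (length alive) → World
  world = lookup alive

  open FiniteKripke {_≺_ = λ i j → world i ≺ world j} (λ i j → world i ≺? world j) ≺-trans
    (λ i p → look Λ (world i) (atom p))

  ⟦⟧≡eval : ∀ D → boxed D ⊆ Bs → ∀ i → ⟦ D ⟧ i ≡ eval (look Λ (world i)) D
  ⟦⟧≡eval (atom p) _  i = refl
  ⟦⟧≡eval ⊥′       _  i = refl
  ⟦⟧≡eval (X ⇒ Y)  D⊆ i = cong₂ (λ x y → if x then y else true)
    (⟦⟧≡eval X (D⊆ ∘ ∈-++⁺ˡ) i) (⟦⟧≡eval Y (D⊆ ∘ ∈-++⁺ʳ (boxed X)) i)
  ⟦⟧≡eval (□ E)    D⊆ i = T-ext ⟦□E⟧⇒⊨□E ⊨□E⇒⟦□E⟧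
    where
    E∈ : E ∈ Bs
    E∈ = D⊆ (here refl)

    IH : ∀ j → ⟦ E ⟧ j ≡ eval (look Λ (world j)) E
    IH = ⟦⟧≡eval E (D⊆ ∘ there)

    ⊨□E⇒⟦□E⟧ : world i ⊨ □ E → T (⟦ □ E ⟧ i)
    ⊨□E⇒⟦□E⟧ i⊨□E = from (⟦□⟧ E) λ j i≺j →
      subst T (sym (IH j)) (proj₁ (All.lookup i≺j E∈ i⊨□E))

    ⟦□E⟧⇒⊨□E : T (⟦ □ E ⟧ i) → world i ⊨ □ E
    ⟦□E⟧⇒⊨□E ⟦□E⟧ with All.lookup (All.lookup alive-supported (∈-lookup {xs = alive} i)) E∈
    ... | inj₁ i⊨□E = i⊨□E
    ... | inj₂ witness with lookup-index witness
    ... | i≺j , j⊭E =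
      ⊥-elim (j⊭E (subst T (IH (index witness)) (to (⟦□⟧ E) ⟦□E⟧ (index witness) i≺j)))

  alive⊨ : ProvabilityValid A → ∀ {w} → w ∈ alive → w ⊨ A
  alive⊨ valid w∈ = subst (_⊨ A) (sym (lookup-index w∈))
    (subst T (⟦⟧≡eval A id (index w∈)) (provabilityValid⇒⟦⟧ A valid (index w∈)))

theorem3p9 : ∀ (A : Formula)
    → (∀ (P : PreModel) → IsProvabilityModel P → IsFinite P → IsTransitive P
    → HasNecessitation P → ∀ (w : W P) → _⊩_ P w A)
    → K4 ⊢ A
theorem3p9 A valid = ⊢-if-countermodels-refutable (letters⊆subletters A) λ w w⊭A →
  dead-refutable w (w⊭A ∘ alive⊨ valid)
  where open Completeness A
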